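{- If $H$ is a snipped subgraph of a finite simple graph $G$, then $J(H)$ is (isomorphic to) a subgraph of $J(G)$.
   Context: The jump graph $J(G)$ has vertex set $E(G)$, two vertices adjacent iff the corresponding edges of $G$ share no endpoint. A quotient graph $Q$ of $G$ is obtained from a partition of $V(G)$: its vertices are the classes $[v]$, and $\{[u],[v]\}\in E(Q)$ iff $[u]\neq[v]$ and there is an edge $\{u',v'\}\in E(G)$ with $u'\in[u]$, $v'\in[v]$. A snipped subgraph of $G$ is a quotient graph of a subgraph of $G$. -}

module Defs where

open import Data.Nat using (ℕ)
open import Data.Bool using (Bool; true; false)
open import Data.Fin using (Fin; _<_)
open import Data.Product using (Σ; ∃; ∃-syntax; _×_; _,_)
open import Relation.Binary.PropositionalEquality using (_≡_; _≢_)
open import Relation.Nullary using (¬_)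
open import Function.Definitions using (Injective; Surjective)
open import Function.Bundles using (_⇔_)

record Graph : Set where
  field
    size       : ℕ
    adj        : Fin size → Fin size → Bool
    adj-sym    : ∀ u v → adj u v ≡ adj v u
    adj-irrefl : ∀ v → adj v v ≡ false
open Graph public

-- An edge {u , v} of G, stored canonically with u < v.
record Edge (G : Graph) : Set where
  constructor edge
  field
    src   : Fin (size G)
    tgt   : Fin (size G)
    ord   : src < tgt
    isAdj : adj G src tgt ≡ true
open Edge public

JAdj : (G : Graph) → Edge G → Edge G → Set
JAdj G e f = (src e ≢ src f) × (src e ≢ tgt f) × (tgt e ≢ src f) × (tgt e ≢ tgt f)

IsSubgraph : Graph → Graph → Set
IsSubgraph S G =
  Σ (Fin (size S) → Fin (size G)) λ ι →
    Injective _≡_ _≡_ ι × (∀ u v → adj S u v ≡ true → adj G (ι u) (ι v) ≡ true)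

-- Q is (isomorphic to) the quotient graph of S by the partition whose classes are
-- the fibres of the surjection c : V(S) → V(Q).
IsQuotient : Graph → Graph → Set
IsQuotient Q S =
  Σ (Fin (size S) → Fin (size Q)) λ c →
    Surjective _≡_ _≡_ c ×
    (∀ a b → (adj Q a b ≡ true) ⇔
       ((a ≢ b) × ∃[ u ] ∃[ v ] (c u ≡ a × c v ≡ b × adj S u v ≡ true)))

IsSnipped : Graph → Graph → Set
IsSnipped H G = Σ Graph λ S → IsSubgraph S G × IsQuotient H S

JumpSubgraph : Graph → Graph → Set
JumpSubgraph H G =
  Σ (Edge H → Edge G) λ f →
    Injective _≡_ _≡_ f × (∀ e e' → JAdj H e e' → JAdj G (f e) (f e'))

{-# OPTIONS --safe #-}
module Submission where

open import Defs
open import Data.Bool using (true)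
open import Data.Bool.Properties using () renaming (_≟_ to _≟ᵇ_)
open import Data.Fin using (Fin; _<_)
open import Data.Fin.Properties using (<-cmp; <-asym; <-irrelevant)
open import Data.Product using (Σ; ∃-syntax; _×_; _,_; proj₁; proj₂)
open import Data.Sum using (_⊎_; inj₁; inj₂)
open import Data.Empty using (⊥; ⊥-elim)
open import Relation.Binary.PropositionalEquality
open import Relation.Binary.Definitions using (tri<; tri≈; tri>)
open import Function.Bundles using (_⇔_; Equivalence)
open import Function.Definitions using (Injective)
open import Axiom.UniquenessOfIdentityProofs using (module Decidable⇒UIP)

-- Idea: lift each edge {a , b} of H to an edge {u , v} of the subgraph S with
-- c u = a, c v = b, and send it to the edge {ι u , ι v} of G.  Every endpoint of
-- the image lies over an endpoint of the original edge, and "lying over" is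
-- functional because ι is injective; hence edges with disjoint endpoints go to
-- edges with disjoint endpoints, and an edge of H is recovered from its image.

module _ {G : Graph} where

  data _∈ₑ_ (z : Fin (size G)) (e : Edge G) : Set where
    src∈ : z ≡ src e → z ∈ₑ e
    tgt∈ : z ≡ tgt e → z ∈ₑ e

  data Spans (e : Edge G) (x y : Fin (size G)) : Set where
    forwards  : src e ≡ x → tgt e ≡ y → Spans e x y
    backwards : src e ≡ y → tgt e ≡ x → Spans e x y

  Edge-≡ : {e e' : Edge G} → src e ≡ src e' → tgt e ≡ tgt e' → e ≡ e'
  Edge-≡ {edge s t o a} {edge .s .t o' a'} refl refl
    with <-irrelevant o o' | Decidable⇒UIP.≡-irrelevant _≟ᵇ_ a a'
  ... | refl | refl = refl

  Spans⇒≡ : {e e' : Edge G} → Spans e (src e') (tgt e') → e ≡ e'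
  Spans⇒≡ (forwards s t) = Edge-≡ s t
  Spans⇒≡ {e} {e'} (backwards s t) =
    ⊥-elim (<-asym (ord e) (subst₂ _<_ (sym t) (sym s) (ord e')))

  Spans-endpoint : {e : Edge G} {x y z : Fin (size G)} →
                   Spans e x y → z ∈ₑ e → z ≡ x ⊎ z ≡ y
  Spans-endpoint (forwards  refl _) (src∈ refl) = inj₁ refl
  Spans-endpoint (forwards  _ refl) (tgt∈ refl) = inj₂ refl
  Spans-endpoint (backwards refl _) (src∈ refl) = inj₂ refl
  Spans-endpoint (backwards _ refl) (tgt∈ refl) = inj₁ refl

  Spans-unique : {e : Edge G} {x y x' y' : Fin (size G)} →
                 Spans e x y → Spans e x' y' →
                 (x ≡ x' × y ≡ y') ⊎ (x ≡ y' × y ≡ x')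
  Spans-unique (forwards  refl refl) (forwards  refl refl) = inj₁ (refl , refl)
  Spans-unique (forwards  refl refl) (backwards refl refl) = inj₂ (refl , refl)
  Spans-unique (backwards refl refl) (forwards  refl refl) = inj₂ (refl , refl)
  Spans-unique (backwards refl refl) (backwards refl refl) = inj₁ (refl , refl)

  edgeBetween : {x y : Fin (size G)} → x ≢ y → adj G x y ≡ true →
                Σ (Edge G) λ e → Spans e x y
  edgeBetween {x} {y} x≢y xy with <-cmp x y
  ... | tri< x<y _ _ = edge x y x<y xy , forwards refl refl
  ... | tri≈ _ x≡y _ = ⊥-elim (x≢y x≡y)
  ... | tri> _ _ y<x = edge y x y<x (trans (adj-sym G y x) xy) , backwards refl refl

  JAdj-intro : {e e' : Edge G} →
               (∀ {z} → z ∈ₑ e → z ∈ₑ e' → ⊥) → JAdj G e e'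
  JAdj-intro disjoint =
      (λ eq → disjoint (src∈ refl) (src∈ eq))
    , (λ eq → disjoint (src∈ refl) (tgt∈ eq))
    , (λ eq → disjoint (tgt∈ refl) (src∈ eq))
    , (λ eq → disjoint (tgt∈ refl) (tgt∈ eq))

  JAdj-disjoint : {e e' : Edge G} {z : Fin (size G)} →
                  JAdj G e e' → z ∈ₑ e → z ∈ₑ e' → ⊥
  JAdj-disjoint (p , _ , _ , _) (src∈ refl) (src∈ eq) = p eq
  JAdj-disjoint (_ , q , _ , _) (src∈ refl) (tgt∈ eq) = q eq
  JAdj-disjoint (_ , _ , r , _) (tgt∈ refl) (src∈ eq) = r eq
  JAdj-disjoint (_ , _ , _ , s) (tgt∈ refl) (tgt∈ eq) = s eq

record Over {G H : Graph} (R : Fin (size G) → Fin (size H) → Set)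
            (e : Edge H) (g : Edge G) : Set where
  constructor over
  field
    {x y}    : Fin (size G)
    spans    : Spans g x y
    src-over : R x (src e)
    tgt-over : R y (tgt e)

Over-endpoint : {G H : Graph} {R : Fin (size G) → Fin (size H) → Set}
                {e : Edge H} {g : Edge G} {z : Fin (size G)} →
                Over R e g → z ∈ₑ g → ∃[ a ] a ∈ₑ e × R z a
Over-endpoint (over sp Rx Ry) z∈g with Spans-endpoint sp z∈g
... | inj₁ refl = _ , src∈ refl , Rx
... | inj₂ refl = _ , tgt∈ refl , Ry

module _ {G H : Graph} {R : Fin (size G) → Fin (size H) → Set}
         (R-functional : ∀ {x a b} → R x a → R x b → a ≡ b) where

  Over-injective : {e e' : Edge H} {g : Edge G} → Over R e g → Over R e' g → e ≡ e'
  Over-injective (over sp Rx Ry) (over sp' Rx' Ry')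
    with Spans-unique sp sp'
  ... | inj₁ (refl , refl) = Spans⇒≡ (forwards (R-functional Rx Rx') (R-functional Ry Ry'))
  ... | inj₂ (refl , refl) = Spans⇒≡ (backwards (R-functional Rx Ry') (R-functional Ry Rx'))

  Over-JAdj : {e e' : Edge H} {g g' : Edge G} →
              Over R e g → Over R e' g' → JAdj H e e' → JAdj G g g'
  Over-JAdj o o' j = JAdj-intro λ z∈g z∈g' →
    let a  , a∈e   , Rza  = Over-endpoint o  z∈g
        a' , a'∈e' , Rza' = Over-endpoint o' z∈g'
    in JAdj-disjoint j a∈e (subst (_∈ₑ _) (R-functional Rza' Rza) a'∈e')

  jumpSubgraph-byLifting : (∀ e → Σ (Edge G) (Over R e)) → JumpSubgraph H G
  jumpSubgraph-byLifting lift =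
      (λ e → proj₁ (lift e))
    , (λ {e} {e'} eq → Over-injective (proj₂ (lift e))
                         (subst (Over R e') (sym eq) (proj₂ (lift e'))))
    , (λ e e' → Over-JAdj (proj₂ (lift e)) (proj₂ (lift e')))

module Snipping {G S H : Graph}
         (ι : Fin (size S) → Fin (size G)) (ι-injective : Injective _≡_ _≡_ ι)
         (ι-adj : ∀ u v → adj S u v ≡ true → adj G (ι u) (ι v) ≡ true)
         (c : Fin (size S) → Fin (size H))
         (c-adj : ∀ a b → (adj H a b ≡ true) ⇔
                    ((a ≢ b) × ∃[ u ] ∃[ v ] (c u ≡ a × c v ≡ b × adj S u v ≡ true))) where

  LiesOver : Fin (size G) → Fin (size H) → Set
  LiesOver x a = ∃[ w ] ι w ≡ x × c w ≡ a

  LiesOver-functional : ∀ {x a b} → LiesOver x a → LiesOver x b → a ≡ b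
  LiesOver-functional (_ , refl , refl) (_ , ιw≡ιw′ , refl) =
    cong c (ι-injective (sym ιw≡ιw′))

  liftEdge : (e : Edge H) → Σ (Edge G) (Over LiesOver e)
  liftEdge e with Equivalence.to (c-adj (src e) (tgt e)) (isAdj e)
  ... | src≢tgt , u , v , refl , refl , uv =
    let g , sp = edgeBetween (λ ιu≡ιv → src≢tgt (cong c (ι-injective ιu≡ιv))) (ι-adj u v uv)
    in g , over sp (u , refl , refl) (v , refl , refl)

mainTheorem10 : (G H : Graph) → IsSnipped H G → JumpSubgraph H G
mainTheorem10 G H (S , (ι , ι-injective , ι-adj) , (c , _ , c-adj)) =
  jumpSubgraph-byLifting LiesOver-functional liftEdge
  where open Snipping {G} {S} {H} ι ι-injective ι-adj c c-adj
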